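{- Let $s>0$ and $\beta>1+s$. There exists $N_0$ (depending only on $s$ and $\beta$) such that for every integer $N\ge N_0$ and every collection $\mathcal S_N$ of $N$-sets in $[N^2]$ with $|\mathcal S_N|\le N^{1+s}$ we have $$C(\mathcal S_N)\le \frac{\beta\log N}{\log\log N}.$$
   Context: For an integer $M$, $[M]$ denotes a set with $M$ elements. An $N$-set is a subset of $[N^2]$ with exactly $N$ elements. For a collection $\mathcal S$ of $N$-sets in $[N^2]$, $$C(\mathcal S)=\min_{S'}\max_{S\in\mathcal S}|S\cap S'|,$$ where the minimum is over all $N$-sets $S'$ in $[N^2]$.
   Formalization: The parameters s and β take only positive rational values. -}

module Defs where

open import Data.Nat using (ℕ; zero; suc; _+_; _*_; _^_; _≤_; _!; _⊔_; _⊓_; NonZero)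
open import Data.Nat.Properties using (_≟_)
open import Data.Bool using (true; false)
open import Data.Vec using ([]; _∷_)
open import Data.List using (List; []; _∷_; map; _++_; filter; foldr)
open import Data.Fin.Subset using (Subset; _∩_; ∣_∣)

allSubsets : (m : ℕ) → List (Subset m)
allSubsets zero    = [] ∷ []
allSubsets (suc m) = map (true ∷_) (allSubsets m) ++ map (false ∷_) (allSubsets m)

nSets : (N : ℕ) → List (Subset (N * N))
nSets N = filter (λ S → ∣ S ∣ ≟ N) (allSubsets (N * N))

-- maximum / minimum of a list of naturals
-- (maxList [] = 0; minList is only applied to the nonempty list nSets N)
maxList : List ℕ → ℕ
maxList = foldr _⊔_ 0

minList : List ℕ → ℕ
minList []       = 0
minList (x ∷ xs) = foldr _⊓_ x xs

C : (N : ℕ) → List (Subset (N * N)) → ℕ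
C N 𝒮 = minList (map (λ S' → maxList (map (λ S → ∣ S ∩ S' ∣) 𝒮)) (nSets N))

-- expT u n = n! · Σ_{k<n} u^k / k!   (n! times the n-th partial sum of e^u)
expT : ℕ → ℕ → ℕ
expT u zero    = 0
expT u (suc n) = suc n * (expT u n + u ^ n)

-- ExpLe u v N  ⟺  e^u ≤ N^v  ⟺  u / v ≤ ln N   (for v > 0)
ExpLe : ℕ → ℕ → ℕ → Set
ExpLe u v N = (n : ℕ) → expT u n ≤ N ^ v * n !

-- LnPowLe N m M  ⟺  (ln N)^m ≤ M   (for N ≥ 2):
-- every nonnegative rational u/v ≤ ln N satisfies (u/v)^m ≤ M.
LnPowLe : ℕ → ℕ → ℕ → Set
LnPowLe N m M = (u v : ℕ) → .{{_ : NonZero v}} → ExpLe u v N → u ^ m ≤ M * v ^ m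

-- LogBound c d N K  ⟺  K ≤ (c/d) · log N / log log N   (for N ≥ 3), since
-- K log log N ≤ β log N ⟺ (log N)^K ≤ N^β ⟺ (log N)^(K d) ≤ N^c, β = c/d.
LogBound : ℕ → ℕ → ℕ → ℕ → Set
LogBound c d N K = LnPowLe N (K * d) (N ^ c)

-- Split [N²] into N blocks of N points and compare each S ∈ 𝒮 with the N^N transversals
-- S' (one point per block).  Counting T-subsets of S block by block gives
--   ∑_{S'} (|S ∩ S'| choose T) · T! · N^T ≤ N^N · |S|^T,
-- so for N-sets ∑_{S'} ∑_{S ∈ 𝒮} (|S ∩ S'| choose T) ≤ |𝒮| · N^N / T!, and if |𝒮| < T! some
-- transversal meets every S in fewer than T points, i.e. C(𝒮) < T.
-- With J = ⌊log₂ N⌋ let K be the largest integer with (2J)^(Kd) < 2^(cJ), so that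
-- K ≈ β log N / log log N.  Since e^x ≥ x^j / j!, one has ln N ≤ J · N^(1/J), which turns
-- (2J)^(Kd) ≤ 2^(cJ) into (ln N)^(Kd) ≤ N^c.  On the other hand T = K + 1 satisfies
-- log T! ≈ T log T ≈ β log N > (1 + s) log N, so |𝒮| ≤ N^(1+s) < T!.  To make this precise,
-- T! ≥ m^(T - m) for a power of two m ≈ (2J)^((q+1)/(q+2)), where q = 2(b + a)d + 1 is
-- large enough for the loss to be absorbed by the gap between β and 1 + s.
module Submission where

open import Defs
open import Data.Nat using (ℕ; _+_; _*_; _^_; _≤_; _<_; NonZero)
open import Data.Product using (Σ; ∃-syntax)
open import Data.List using (List; length)
open import Data.List.Relation.Unary.All using (All)
open import Data.List.Relation.Unary.Unique.Propositional using (Unique)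
open import Data.Fin.Subset using (Subset; ∣_∣)
open import Relation.Binary.PropositionalEquality using (_≡_)

open import Data.Nat using (zero; suc; _∸_; _!; _⊓_; z≤n; s≤s; s≤s⁻¹; _≤?_; _<?_; >-nonZero; >-nonZero⁻¹)
open import Data.Nat.Properties
open import Data.Nat.Combinatorics using (nCk+nC[k+1]≡[n+1]C[k+1]) renaming (_C_ to _choose_)
open import Data.Nat.ListAction using () renaming (sum to sumₗ)
open import Data.Nat.Tactic.RingSolver using (solve-∀)
import Algebra.Properties.CommutativeSemigroup *-commutativeSemigroup as *-Comm
import Algebra.Properties.CommutativeSemigroup +-commutativeSemigroup as +-Comm
open import Algebra.Properties.Semiring.Sum +-*-semiring
  using (sum; sum-syntax; sum-cong-≗; *-distribˡ-sum; *-distribʳ-sum)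
open import Data.Bool using (true; false; _∧_)
open import Data.Empty using (⊥-elim)
open import Data.Fin using (Fin; zero; suc)
open import Data.Fin.Subset using (_∩_; ⁅_⁆)
open import Data.Fin.Subset.Properties using (∩-zeroʳ; ∣⊥∣≡0; ∣p∩q∣≤∣q∣; ∣⁅x⁆∣≡1)
open import Data.List using ([]; _∷_; map)
open import Data.List.Properties using (foldr-preservesᵇ; foldr-preservesᵒ)
open import Data.List.Membership.Propositional using (_∈_)
open import Data.List.Membership.Propositional.Properties using (∈-map⁺; ∈-++⁺ˡ; ∈-++⁺ʳ; ∈-filter⁺)
open import Data.List.Relation.Unary.All using ([]; _∷_)
import Data.List.Relation.Unary.All.Properties as All
open import Data.List.Relation.Unary.Any as Any using (Any; here; there)
open import Data.Product using (∃; _×_; _,_)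
open import Data.Sum using (_⊎_; inj₁; inj₂; [_,_])
open import Data.Vec using (Vec; []; _∷_; _++_; splitAt)
open import Data.Vec.Properties using (zipWith-++)
open import Function using (_∘_)
open import Relation.Binary.PropositionalEquality using (refl; sym; trans; cong; cong₂)
open import Relation.Nullary using (¬_; yes; no)
open import Relation.Unary using (Decidable)

^-distribʳ-* : ∀ m n o → (m * n) ^ o ≡ m ^ o * n ^ o
^-distribʳ-* m n zero    = refl
^-distribʳ-* m n (suc o) =
  trans (cong (m * n *_) (^-distribʳ-* m n o)) (*-Comm.interchange m n (m ^ o) (n ^ o))

^-swap : ∀ m n o → (m ^ n) ^ o ≡ (m ^ o) ^ n
^-swap m n o = trans (^-*-assoc m n o) (trans (cong (m ^_) (*-comm n o)) (sym (^-*-assoc m o n)))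

^-cancelʳ-≤ : ∀ {m o} n .{{_ : NonZero n}} → m ^ n ≤ o ^ n → m ≤ o
^-cancelʳ-≤ n mⁿ≤oⁿ = ≮⇒≥ (λ o<m → <⇒≱ (^-monoˡ-< n o<m) mⁿ≤oⁿ)

^-cancelʳ-< : ∀ {m o} n → m ^ n < o ^ n → m < o
^-cancelʳ-< n mⁿ<oⁿ = ≰⇒> (λ o≤m → <⇒≱ mⁿ<oⁿ (^-monoˡ-≤ n o≤m))

^-cancelˡ-≤ : ∀ m {n o} → 1 < m → m ^ n ≤ m ^ o → n ≤ o
^-cancelˡ-≤ m 1<m mⁿ≤mᵒ = ≮⇒≥ (λ o<n → <⇒≱ (^-monoʳ-< m 1<m o<n) mⁿ≤mᵒ)

^-cancelˡ-< : ∀ m .{{_ : NonZero m}} {n o} → m ^ n < m ^ o → n < o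
^-cancelˡ-< m mⁿ<mᵒ = ≰⇒> (λ o≤n → <⇒≱ mⁿ<mᵒ (^-monoʳ-≤ m o≤n))

n<m^n : ∀ {m} → 1 < m → ∀ n → n < m ^ n
n<m^n 1<m zero = s≤s z≤n
n<m^n {m@(suc _)} 1<m (suc n) = begin-strict
  suc n      ≤⟨ n<m^n 1<m n ⟩
  m ^ n      <⟨ m<m*n (m ^ n) m {{m^n≢0 m n}} 1<m ⟩
  m ^ n * m  ≡⟨ *-comm (m ^ n) m ⟩
  m * m ^ n  ∎
  where open ≤-Reasoning

threshold : ∀ {p} {P : ℕ → Set p} → Decidable P → ¬ P 0 → ∀ {n} → P n → ∃[ k ] (¬ P k × P (suc k))
threshold P? ¬P0 {zero}  P0 = ⊥-elim (¬P0 P0)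
threshold P? ¬P0 {suc n} Pn with P? n
... | yes Pn-1 = threshold P? ¬P0 Pn-1
... | no ¬Pn-1 = n , ¬Pn-1 , Pn

∃-power-bracket : ∀ x y → 1 < x → 1 < y → ∃[ k ] (x ^ k < y × y ≤ x ^ suc k)
∃-power-bracket x y 1<x 1<y
  with k , y≰xᵏ , y≤x¹⁺ᵏ ← threshold (λ k → y ≤? x ^ k) (<⇒≱ 1<y) {n = y} (<⇒≤ (n<m^n 1<x y))
  = k , ≰⇒> y≰xᵏ , y≤x¹⁺ᵏ

∃-⌊log₂⌋ : ∀ N → 1 ≤ N → ∃[ J ] (2 ^ J ≤ N × N < 2 ^ suc J)
∃-⌊log₂⌋ N 1≤N =
  let J , 2^J<1+N , 1+N≤2^[1+J] = ∃-power-bracket 2 (suc N) (s≤s (s≤s z≤n)) (s≤s 1≤N)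
  in J , s≤s⁻¹ 2^J<1+N , 1+N≤2^[1+J]

m^n≤[m+n]! : ∀ m n → m ^ n ≤ (m + n) !
m^n≤[m+n]! m zero    = ≤-trans (1≤n! m) (≤-reflexive (cong _! (sym (+-identityʳ m))))
m^n≤[m+n]! m (suc n) = begin
  m * m ^ n                ≤⟨ *-mono-≤ (m≤m+n m (suc n)) (m^n≤[m+n]! m n) ⟩
  (m + suc n) * (m + n) !  ≡⟨ cong (λ k → k * (m + n) !) (+-suc m n) ⟩
  suc (m + n) !            ≡⟨ cong _! (sym (+-suc m n)) ⟩
  (m + suc n) !            ∎
  where open ≤-Reasoning

n!≤n^n : ∀ n → n ! ≤ n ^ n
n!≤n^n zero    = ≤-refl
n!≤n^n (suc n) = *-monoʳ-≤ (suc n) (≤-trans (n!≤n^n n) (^-monoˡ-≤ n (n≤1+n n)))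

[4+n]*[4+n]≤2^[4+n] : ∀ n → (4 + n) * (4 + n) ≤ 2 ^ (4 + n)
[4+n]*[4+n]≤2^[4+n] zero    = ≤-refl
[4+n]*[4+n]≤2^[4+n] (suc n) = begin
  (5 + n) * (5 + n)        ≤⟨ m≤m+n _ (7 + 6 * n + n * n) ⟩
  (5 + n) * (5 + n) + (7 + 6 * n + n * n)
                           ≡⟨ expand n ⟩
  2 * ((4 + n) * (4 + n))  ≤⟨ *-monoʳ-≤ 2 ([4+n]*[4+n]≤2^[4+n] n) ⟩
  2 * 2 ^ (4 + n)          ∎
  where
  open ≤-Reasoning
  expand : ∀ n → (5 + n) * (5 + n) + (7 + 6 * n + n * n) ≡ 2 * ((4 + n) * (4 + n))
  expand = solve-∀

m*[1+n]≤2^n : ∀ m n → 4 + m ≤ n → m * suc n ≤ 2 ^ n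
m*[1+n]≤2^n m n 4+m≤n with o , refl ← m≤n⇒∃[o]m+o≡n (≤-trans (m≤m+n 4 m) 4+m≤n) = begin
  m * suc (4 + o)          ≡⟨ *-suc m (4 + o) ⟩
  m + m * (4 + o)          ≤⟨ +-monoˡ-≤ (m * (4 + o)) (≤-trans (n≤1+n m) 1+m≤n) ⟩
  suc m * (4 + o)          ≤⟨ *-monoˡ-≤ (4 + o) 1+m≤n ⟩
  (4 + o) * (4 + o)        ≤⟨ [4+n]*[4+n]≤2^[4+n] o ⟩
  2 ^ (4 + o)              ∎
  where
  open ≤-Reasoning
  1+m≤n : suc m ≤ 4 + o
  1+m≤n = ≤-trans (+-monoˡ-≤ m (s≤s z≤n)) 4+m≤n

sum-mono-≤ : ∀ {n} {f g : Fin n → ℕ} → (∀ i → f i ≤ g i) → sum f ≤ sum g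
sum-mono-≤ {zero}  f≤g = z≤n
sum-mono-≤ {suc n} f≤g = +-mono-≤ (f≤g zero) (sum-mono-≤ (f≤g ∘ suc))

sum-distrib-+ : ∀ {n} (f g : Fin n → ℕ) → ∑[ i < n ] (f i + g i) ≡ sum f + sum g
sum-distrib-+ {zero}  f g = refl
sum-distrib-+ {suc n} f g =
  trans (cong (f zero + g zero +_) (sum-distrib-+ (f ∘ suc) (g ∘ suc)))
        (+-Comm.interchange (f zero) (g zero) (sum (f ∘ suc)) (sum (g ∘ suc)))

sum-const : ∀ n c → ∑[ i < n ] c ≡ n * c
sum-const zero    c = refl
sum-const (suc n) c = cong (c +_) (sum-const n c)

sum<n*b⇒∃<b : ∀ {n} (f : Fin n → ℕ) {b} → sum f < n * b → ∃[ i ] f i < b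
sum<n*b⇒∃<b {suc n} f {b} Σf<[1+n]b with f zero <? b
... | yes f₀<b = zero , f₀<b
... | no  f₀≮b = let i , fᵢ<b = sum<n*b⇒∃<b (f ∘ suc) Σtail<nb in suc i , fᵢ<b
  where
  open ≤-Reasoning
  Σtail<nb : sum (f ∘ suc) < n * b
  Σtail<nb = +-cancelˡ-< b _ _ (begin-strict
    b + sum (f ∘ suc)  ≤⟨ +-monoˡ-≤ (sum (f ∘ suc)) (≮⇒≥ f₀≮b) ⟩
    sum f              <⟨ Σf<[1+n]b ⟩
    b + n * b          ∎)

∑∣p∩⁅x⁆∣≡∣p∣ : ∀ {n} (p : Subset n) → ∑[ x < n ] ∣ p ∩ ⁅ x ⁆ ∣ ≡ ∣ p ∣
∑∣p∩⁅x⁆∣≡∣p∣ []          = refl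
∑∣p∩⁅x⁆∣≡∣p∣ {suc n} (true  ∷ p) rewrite ∩-zeroʳ p | ∣⊥∣≡0 n = cong suc (∑∣p∩⁅x⁆∣≡∣p∣ p)
∑∣p∩⁅x⁆∣≡∣p∣ {suc n} (false ∷ p) rewrite ∩-zeroʳ p | ∣⊥∣≡0 n = ∑∣p∩⁅x⁆∣≡∣p∣ p

∣p∩⁅x⁆∣≤1 : ∀ {n} (p : Subset n) x → ∣ p ∩ ⁅ x ⁆ ∣ ≤ 1
∣p∩⁅x⁆∣≤1 p x = ≤-trans (∣p∩q∣≤∣q∣ p ⁅ x ⁆) (≤-reflexive (∣⁅x⁆∣≡1 x))

∣p++q∣≡∣p∣+∣q∣ : ∀ {m n} (p : Subset m) (q : Subset n) → ∣ p ++ q ∣ ≡ ∣ p ∣ + ∣ q ∣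
∣p++q∣≡∣p∣+∣q∣ []          q = refl
∣p++q∣≡∣p∣+∣q∣ (true  ∷ p) q = cong suc (∣p++q∣≡∣p∣+∣q∣ p q)
∣p++q∣≡∣p∣+∣q∣ (false ∷ p) q = ∣p++q∣≡∣p∣+∣q∣ p q

∣[p++q]∩[r++s]∣ : ∀ {m n} (p r : Subset m) (q s : Subset n) →
                  ∣ (p ++ q) ∩ (r ++ s) ∣ ≡ ∣ p ∩ r ∣ + ∣ q ∩ s ∣
∣[p++q]∩[r++s]∣ p r q s rewrite zipWith-++ _∧_ p q r s = ∣p++q∣≡∣p∣+∣q∣ (p ∩ r) (q ∩ s)

choose≡0⇒< : ∀ n k → n choose k ≡ 0 → n < k
choose≡0⇒< zero    (suc k) _ = s≤s z≤n
choose≡0⇒< (suc n) (suc k) [1+n]choose[1+k]≡0 = s≤s (choose≡0⇒< n k (m+n≡0⇒m≡0 (n choose k)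
  (trans (nCk+nC[k+1]≡[n+1]C[k+1] n k) [1+n]choose[1+k]≡0)))

choose-pascal-≤ : ∀ {b} n k → b ≤ 1 → (b + n) choose suc k ≤ n choose suc k + b * (n choose k)
choose-pascal-≤ {zero}  n k _ = m≤m+n (n choose suc k) 0
choose-pascal-≤ {suc zero} n k _ = begin
  suc n choose suc k                 ≡⟨ sym (nCk+nC[k+1]≡[n+1]C[k+1] n k) ⟩
  n choose k + n choose suc k        ≡⟨ +-comm (n choose k) (n choose suc k) ⟩
  n choose suc k + n choose k        ≤⟨ +-monoʳ-≤ (n choose suc k) (m≤m+n (n choose k) 0) ⟩
  n choose suc k + 1 * (n choose k)  ∎
  where open ≤-Reasoning
choose-pascal-≤ {suc (suc _)} n k (s≤s ())

n^[1+k]+[1+k]*m*n^k≤[m+n]^[1+k] : ∀ k m n → n ^ suc k + suc k * m * n ^ k ≤ (m + n) ^ suc k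
n^[1+k]+[1+k]*m*n^k≤[m+n]^[1+k] zero m n = ≤-reflexive (base m n)
  where
  base : ∀ m n → n * 1 + 1 * m * 1 ≡ (m + n) * 1
  base = solve-∀
n^[1+k]+[1+k]*m*n^k≤[m+n]^[1+k] (suc k) m n = begin
  n ^ (2 + k) + (2 + k) * m * n ^ (1 + k)
    ≤⟨ m≤m+n _ (suc k * m * m * n ^ k) ⟩
  n ^ (2 + k) + (2 + k) * m * n ^ (1 + k) + suc k * m * m * n ^ k
    ≡⟨ factor k m n (n ^ k) ⟩
  (m + n) * (n ^ suc k + suc k * m * n ^ k)
    ≤⟨ *-monoʳ-≤ (m + n) (n^[1+k]+[1+k]*m*n^k≤[m+n]^[1+k] k m n) ⟩
  (m + n) ^ (2 + k) ∎
  where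
  open ≤-Reasoning
  factor : ∀ k m n nᵏ → n * (n * nᵏ) + (2 + k) * m * (n * nᵏ) + (1 + k) * m * m * nᵏ
                       ≡ (m + n) * (n * nᵏ + (1 + k) * m * nᵏ)
  factor = solve-∀

allSubsets-complete : ∀ {m} (S : Subset m) → S ∈ allSubsets m
allSubsets-complete []                = here refl
allSubsets-complete {suc m} (true  ∷ S) = ∈-++⁺ˡ (∈-map⁺ (true ∷_) (allSubsets-complete S))
allSubsets-complete {suc m} (false ∷ S) =
  ∈-++⁺ʳ (map (true ∷_) (allSubsets m)) (∈-map⁺ (false ∷_) (allSubsets-complete S))

minList-≤ : ∀ {x xs} → x ∈ xs → minList xs ≤ x
minList-≤ {x} {y ∷ ys} x∈y∷ys = foldr-preservesᵒ ⊓-≤ y ys (member x∈y∷ys)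
  where
  ⊓-≤ : ∀ a b → a ≤ x ⊎ b ≤ x → a ⊓ b ≤ x
  ⊓-≤ a b = [ m≤n⇒m⊓o≤n b , m≤n⇒o⊓m≤n a ]
  member : x ∈ y ∷ ys → y ≤ x ⊎ Any (_≤ x) ys
  member (here x≡y)  = inj₁ (≤-reflexive (sym x≡y))
  member (there x∈ys) = inj₂ (Any.map (λ x≡z → ≤-reflexive (sym x≡z)) x∈ys)

maxList-lub : ∀ {k xs} → All (_≤ k) xs → maxList xs ≤ k
maxList-lub = foldr-preservesᵇ ⊔-lub z≤n

C-≤ : ∀ {N K} {𝒮 : List (Subset (N * N))} (S' : Subset (N * N)) → ∣ S' ∣ ≡ N →
      All (λ S → ∣ S ∩ S' ∣ ≤ K) 𝒮 → C N 𝒮 ≤ K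
C-≤ {N} S' ∣S'∣≡N hits≤K = ≤-trans
  (minList-≤ (∈-map⁺ _ (∈-filter⁺ (λ S → ∣ S ∣ ≟ N) (allSubsets-complete S') ∣S'∣≡N)))
  (maxList-lub (All.map⁺ hits≤K))

module _ (N : ℕ) where

  ∑ᵛ : ∀ m → (Vec (Fin N) m → ℕ) → ℕ
  ∑ᵛ zero    g = g []
  ∑ᵛ (suc m) g = ∑[ x < N ] ∑ᵛ m (λ f → g (x ∷ f))

  ∑ᵛ-mono-≤ : ∀ m {g h : Vec (Fin N) m → ℕ} → (∀ f → g f ≤ h f) → ∑ᵛ m g ≤ ∑ᵛ m h
  ∑ᵛ-mono-≤ zero    g≤h = g≤h []
  ∑ᵛ-mono-≤ (suc m) g≤h = sum-mono-≤ (λ x → ∑ᵛ-mono-≤ m (λ f → g≤h (x ∷ f)))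

  ∑ᵛ-distrib-+ : ∀ m (g h : Vec (Fin N) m → ℕ) → ∑ᵛ m (λ f → g f + h f) ≡ ∑ᵛ m g + ∑ᵛ m h
  ∑ᵛ-distrib-+ zero    g h = refl
  ∑ᵛ-distrib-+ (suc m) g h =
    trans (sum-cong-≗ (λ x → ∑ᵛ-distrib-+ m (λ f → g (x ∷ f)) (λ f → h (x ∷ f))))
          (sum-distrib-+ (λ x → ∑ᵛ m (λ f → g (x ∷ f))) (λ x → ∑ᵛ m (λ f → h (x ∷ f))))

  *-distribˡ-∑ᵛ : ∀ m c (g : Vec (Fin N) m → ℕ) → ∑ᵛ m (λ f → c * g f) ≡ c * ∑ᵛ m g
  *-distribˡ-∑ᵛ zero    c g = refl
  *-distribˡ-∑ᵛ (suc m) c g =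
    trans (sum-cong-≗ (λ x → *-distribˡ-∑ᵛ m c (λ f → g (x ∷ f))))
          (sym (*-distribˡ-sum c (λ x → ∑ᵛ m (λ f → g (x ∷ f)))))

  ∑ᵛ-const : ∀ m c → ∑ᵛ m (λ _ → c) ≡ N ^ m * c
  ∑ᵛ-const zero    c = sym (*-identityˡ c)
  ∑ᵛ-const (suc m) c =
    trans (sum-cong-≗ {N} (λ _ → ∑ᵛ-const m c))
          (trans (sum-const N (N ^ m * c)) (sym (*-assoc N (N ^ m) c)))

  ∑ᵛ<N^m⇒∃≡0 : ∀ m (g : Vec (Fin N) m → ℕ) → ∑ᵛ m g < N ^ m → ∃[ f ] g f ≡ 0
  ∑ᵛ<N^m⇒∃≡0 zero    g g[]<1 = [] , n<1⇒n≡0 g[]<1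
  ∑ᵛ<N^m⇒∃≡0 (suc m) g Σg<N^[1+m] =
    let x , Σgₓ<N^m = sum<n*b⇒∃<b (λ x → ∑ᵛ m (λ f → g (x ∷ f))) Σg<N^[1+m]
        f , gₓf≡0   = ∑ᵛ<N^m⇒∃≡0 m (λ f → g (x ∷ f)) Σgₓ<N^m
    in x ∷ f , gₓf≡0

  -- Subset (suc m * N) is Subset (N + m * N) by definition, so a subset of [mN] is a row of
  -- m blocks of N points; a transversal picks one point in each block.
  transversal : ∀ {m} → Vec (Fin N) m → Subset (m * N)
  transversal []      = []
  transversal (x ∷ f) = ⁅ x ⁆ ++ transversal f

  ∣transversal∣ : ∀ {m} (f : Vec (Fin N) m) → ∣ transversal f ∣ ≡ m
  ∣transversal∣ []      = refl
  ∣transversal∣ (x ∷ f) =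
    trans (∣p++q∣≡∣p∣+∣q∣ ⁅ x ⁆ (transversal f)) (cong₂ _+_ (∣⁅x⁆∣≡1 x) (∣transversal∣ f))

  ∑ᵛ-choose-split : ∀ m (p : Subset N) (q : Subset (m * N)) k →
    ∑ᵛ (suc m) (λ f → ∣ (p ++ q) ∩ transversal f ∣ choose suc k)
      ≤ N * ∑ᵛ m (λ f → ∣ q ∩ transversal f ∣ choose suc k)
        + ∣ p ∣ * ∑ᵛ m (λ f → ∣ q ∩ transversal f ∣ choose k)
  ∑ᵛ-choose-split m p q k = begin
    ∑[ x < N ] ∑ᵛ m (λ f → ∣ (p ++ q) ∩ transversal (x ∷ f) ∣ choose suc k)
      ≤⟨ sum-mono-≤ per-block ⟩
    ∑[ x < N ] (A + ∣ p ∩ ⁅ x ⁆ ∣ * B)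
      ≡⟨ sum-distrib-+ (λ _ → A) (λ x → ∣ p ∩ ⁅ x ⁆ ∣ * B) ⟩
    ∑[ x < N ] A + ∑[ x < N ] (∣ p ∩ ⁅ x ⁆ ∣ * B)
      ≡⟨ cong₂ _+_ (sum-const N A)
                   (trans (sym (*-distribʳ-sum B (λ x → ∣ p ∩ ⁅ x ⁆ ∣))) (cong (_* B) (∑∣p∩⁅x⁆∣≡∣p∣ p))) ⟩
    N * A + ∣ p ∣ * B ∎
    where
    open ≤-Reasoning
    hits : Vec (Fin N) m → ℕ
    hits f = ∣ q ∩ transversal f ∣
    A B : ℕ
    A = ∑ᵛ m (λ f → hits f choose suc k)
    B = ∑ᵛ m (λ f → hits f choose k)
    per-block : ∀ x → ∑ᵛ m (λ f → ∣ (p ++ q) ∩ transversal (x ∷ f) ∣ choose suc k)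
                        ≤ A + ∣ p ∩ ⁅ x ⁆ ∣ * B
    per-block x = begin
      ∑ᵛ m (λ f → ∣ (p ++ q) ∩ transversal (x ∷ f) ∣ choose suc k)
        ≤⟨ ∑ᵛ-mono-≤ m (λ f → ≤-trans
             (≤-reflexive (cong (_choose suc k) (∣[p++q]∩[r++s]∣ p ⁅ x ⁆ q (transversal f))))
             (choose-pascal-≤ (hits f) k (∣p∩⁅x⁆∣≤1 p x))) ⟩
      ∑ᵛ m (λ f → hits f choose suc k + ∣ p ∩ ⁅ x ⁆ ∣ * (hits f choose k))
        ≡⟨ trans (∑ᵛ-distrib-+ m _ _) (cong (A +_) (*-distribˡ-∑ᵛ m ∣ p ∩ ⁅ x ⁆ ∣ _)) ⟩
      A + ∣ p ∩ ⁅ x ⁆ ∣ * B ∎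

  ∑ᵛ-hits-choose : ∀ m (S : Subset (m * N)) k →
    ∑ᵛ m (λ f → ∣ S ∩ transversal f ∣ choose k) * k ! * N ^ k ≤ N ^ m * ∣ S ∣ ^ k
  ∑ᵛ-hits-choose m S zero =
    ≤-reflexive (trans (*-identityʳ _) (trans (*-identityʳ _) (∑ᵛ-const m 1)))
  ∑ᵛ-hits-choose zero [] (suc k) = z≤n
  ∑ᵛ-hits-choose (suc m) S (suc k) with p , q , refl ← splitAt N S = begin
    ∑ᵛ (suc m) (λ f → ∣ (p ++ q) ∩ transversal f ∣ choose suc k) * suc k ! * N ^ suc k
      ≤⟨ *-monoˡ-≤ (N ^ suc k) (*-monoˡ-≤ (suc k !) (∑ᵛ-choose-split m p q k)) ⟩
    (N * A + ∣ p ∣ * B) * suc k ! * N ^ suc k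
      ≡⟨ regroup N A ∣ p ∣ B k (k !) (N ^ k) ⟩
    N * (A * suc k ! * N ^ suc k) + suc k * ∣ p ∣ * N * (B * k ! * N ^ k)
      ≤⟨ +-mono-≤ (*-monoʳ-≤ N (∑ᵛ-hits-choose m q (suc k)))
                  (*-monoʳ-≤ (suc k * ∣ p ∣ * N) (∑ᵛ-hits-choose m q k)) ⟩
    N * (N ^ m * ∣ q ∣ ^ suc k) + suc k * ∣ p ∣ * N * (N ^ m * ∣ q ∣ ^ k)
      ≡⟨ factor N (N ^ m) ∣ p ∣ ∣ q ∣ k (∣ q ∣ ^ k) ⟩
    N ^ suc m * (∣ q ∣ ^ suc k + suc k * ∣ p ∣ * ∣ q ∣ ^ k)
      ≤⟨ *-monoʳ-≤ (N ^ suc m) (n^[1+k]+[1+k]*m*n^k≤[m+n]^[1+k] k ∣ p ∣ ∣ q ∣) ⟩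
    N ^ suc m * (∣ p ∣ + ∣ q ∣) ^ suc k
      ≡⟨ cong (λ s → N ^ suc m * s ^ suc k) (sym (∣p++q∣≡∣p∣+∣q∣ p q)) ⟩
    N ^ suc m * ∣ p ++ q ∣ ^ suc k ∎
    where
    open ≤-Reasoning
    A B : ℕ
    A = ∑ᵛ m (λ f → ∣ q ∩ transversal f ∣ choose suc k)
    B = ∑ᵛ m (λ f → ∣ q ∩ transversal f ∣ choose k)
    regroup : ∀ N A r B k k! Nᵏ → (N * A + r * B) * ((1 + k) * k!) * (N * Nᵏ)
                                 ≡ N * (A * ((1 + k) * k!) * (N * Nᵏ)) + (1 + k) * r * N * (B * k! * Nᵏ)
    regroup = solve-∀
    factor : ∀ N Nᵐ r s k sᵏ → N * (Nᵐ * (s * sᵏ)) + (1 + k) * r * N * (Nᵐ * sᵏ)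
                              ≡ N * Nᵐ * (s * sᵏ + (1 + k) * r * sᵏ)
    factor = solve-∀

  ∃-transversal : .{{_ : NonZero N}} → ∀ {K} (𝒮 : List (Subset (N * N))) → All (λ S → ∣ S ∣ ≡ N) 𝒮 →
    length 𝒮 < suc K ! → ∃[ f ] All (λ S → ∣ S ∩ transversal f ∣ ≤ K) 𝒮
  ∃-transversal {K} 𝒮 N-sets |𝒮|<T! =
    let f , overlaps≡0 = ∑ᵛ<N^m⇒∃≡0 N (overlaps 𝒮) ∑overlaps<N^N in f , small-hits 𝒮 {f} overlaps≡0
    where
    T : ℕ
    T = suc K
    overlaps : List (Subset (N * N)) → Vec (Fin N) N → ℕ
    overlaps 𝒮 f = sumₗ (map (λ S → ∣ S ∩ transversal f ∣ choose T) 𝒮)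

    ∑overlaps*T!≤ : ∀ {𝒮} → All (λ S → ∣ S ∣ ≡ N) 𝒮 → ∑ᵛ N (overlaps 𝒮) * T ! ≤ length 𝒮 * N ^ N
    ∑overlaps*T!≤ [] = ≤-reflexive (cong (_* T !) (trans (∑ᵛ-const N 0) (*-zeroʳ (N ^ N))))
    ∑overlaps*T!≤ {S ∷ 𝒮} (∣S∣≡N ∷ N-sets) = begin
      ∑ᵛ N (λ f → ∣ S ∩ transversal f ∣ choose T + overlaps 𝒮 f) * T !
        ≡⟨ trans (cong (_* T !) (∑ᵛ-distrib-+ N _ (overlaps 𝒮)))
                 (*-distribʳ-+ (T !) (∑ᵛ N (λ f → ∣ S ∩ transversal f ∣ choose T)) (∑ᵛ N (overlaps 𝒮))) ⟩
      ∑ᵛ N (λ f → ∣ S ∩ transversal f ∣ choose T) * T ! + ∑ᵛ N (overlaps 𝒮) * T !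
        ≤⟨ +-mono-≤ (*-cancelʳ-≤ _ _ (N ^ T) {{m^n≢0 N T}} single) (∑overlaps*T!≤ N-sets) ⟩
      N ^ N + length 𝒮 * N ^ N ∎
      where
      open ≤-Reasoning
      single : ∑ᵛ N (λ f → ∣ S ∩ transversal f ∣ choose T) * T ! * N ^ T ≤ N ^ N * N ^ T
      single = ≤-trans (∑ᵛ-hits-choose N S T) (≤-reflexive (cong (λ s → N ^ N * s ^ T) ∣S∣≡N))

    ∑overlaps<N^N : ∑ᵛ N (overlaps 𝒮) < N ^ N
    ∑overlaps<N^N = *-cancelʳ-< (T !) _ _ (begin-strict
      ∑ᵛ N (overlaps 𝒮) * T !  ≤⟨ ∑overlaps*T!≤ N-sets ⟩
      length 𝒮 * N ^ N         <⟨ *-monoˡ-< (N ^ N) {{m^n≢0 N N}} |𝒮|<T! ⟩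
      T ! * N ^ N              ≡⟨ *-comm (T !) (N ^ N) ⟩
      N ^ N * T !              ∎)
      where open ≤-Reasoning

    small-hits : ∀ 𝒮 {f} → overlaps 𝒮 f ≡ 0 → All (λ S → ∣ S ∩ transversal f ∣ ≤ K) 𝒮
    small-hits []      _ = []
    small-hits (S ∷ 𝒮) {f} Σ≡0 =
      s≤s⁻¹ (choose≡0⇒< ∣ S ∩ transversal f ∣ T (m+n≡0⇒m≡0 _ Σ≡0))
        ∷ small-hits 𝒮 {f} (m+n≡0⇒n≡0 (∣ S ∩ transversal f ∣ choose T) Σ≡0)

length<[1+K]!⇒C≤K : ∀ {N K} .{{_ : NonZero N}} {𝒮 : List (Subset (N * N))} →
                    All (λ S → ∣ S ∣ ≡ N) 𝒮 → length 𝒮 < suc K ! → C N 𝒮 ≤ K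
length<[1+K]!⇒C≤K {N} {𝒮 = 𝒮} N-sets |𝒮|<[1+K]! =
  let f , hits≤K = ∃-transversal N 𝒮 N-sets |𝒮|<[1+K]!
  in C-≤ (transversal N f) (∣transversal∣ N f) hits≤K

ExpLe⇒u^j≤N^v*j! : ∀ {u v N} → ExpLe u v N → ∀ j → u ^ j ≤ N ^ v * j !
ExpLe⇒u^j≤N^v*j! {u} {v} {N} e^u≤N^v j = *-cancelˡ-≤ (suc j) (begin
  suc j * u ^ j          ≤⟨ *-monoʳ-≤ (suc j) (m≤n+m (u ^ j) (expT u j)) ⟩
  expT u (suc j)         ≤⟨ e^u≤N^v (suc j) ⟩
  N ^ v * (suc j * j !)  ≡⟨ *-Comm.x∙yz≈y∙xz (N ^ v) (suc j) (j !) ⟩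
  suc j * (N ^ v * j !)  ∎)
  where open ≤-Reasoning

-- In terms of x = u/v ≤ ln N: x ≤ J · N^(1/J).
ExpLe⇒u^J≤N*[J*v]^J : ∀ {u v N} .{{_ : NonZero v}} → ExpLe u v N → ∀ J → u ^ J ≤ N * (J * v) ^ J
ExpLe⇒u^J≤N*[J*v]^J {u} {v} {N} e^u≤N^v J = ^-cancelʳ-≤ v (begin
  (u ^ J) ^ v                ≡⟨ ^-*-assoc u J v ⟩
  u ^ (J * v)                ≤⟨ ExpLe⇒u^j≤N^v*j! {v = v} {N} e^u≤N^v (J * v) ⟩
  N ^ v * (J * v) !          ≤⟨ *-monoʳ-≤ (N ^ v) (n!≤n^n (J * v)) ⟩
  N ^ v * (J * v) ^ (J * v)  ≡⟨ cong (N ^ v *_) (sym (^-*-assoc (J * v) J v)) ⟩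
  N ^ v * ((J * v) ^ J) ^ v  ≡⟨ sym (^-distribʳ-* N ((J * v) ^ J) v) ⟩
  (N * (J * v) ^ J) ^ v      ∎)
  where open ≤-Reasoning

N^E*[J^E]^J≤N^[c*J] : ∀ {B N J E} c → 1 < B → .{{_ : NonZero J}} → B ^ J ≤ N →
                      (B * J) ^ E ≤ B ^ (c * J) → N ^ E * (J ^ E) ^ J ≤ N ^ (c * J)
N^E*[J^E]^J≤N^[c*J] {B} {N} {J} {E} c 1<B B^J≤N [BJ]^E≤B^[cJ] = begin
  N ^ E * (J ^ E) ^ J  ≤⟨ *-monoʳ-≤ (N ^ E) (^-monoˡ-≤ J J^E≤B^r) ⟩
  N ^ E * (B ^ r) ^ J  ≡⟨ cong (N ^ E *_) (^-swap B r J) ⟩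
  N ^ E * (B ^ J) ^ r  ≤⟨ *-monoʳ-≤ (N ^ E) (^-monoˡ-≤ r B^J≤N) ⟩
  N ^ E * N ^ r        ≡⟨ sym (^-distribˡ-+-* N E r) ⟩
  N ^ (E + r)          ≡⟨ cong (N ^_) E+r≡cJ ⟩
  N ^ (c * J)          ∎
  where
  open ≤-Reasoning
  instance
    B≢0 : NonZero B
    B≢0 = >-nonZero (<-trans (s≤s z≤n) 1<B)
  [BJ]^E≡B^E*J^E : (B * J) ^ E ≡ B ^ E * J ^ E
  [BJ]^E≡B^E*J^E = ^-distribʳ-* B J E
  E≤cJ : E ≤ c * J
  E≤cJ = ^-cancelˡ-≤ B 1<B (begin
    B ^ E          ≤⟨ m≤m*n (B ^ E) (J ^ E) {{m^n≢0 J E}} ⟩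
    B ^ E * J ^ E  ≡⟨ sym [BJ]^E≡B^E*J^E ⟩
    (B * J) ^ E    ≤⟨ [BJ]^E≤B^[cJ] ⟩
    B ^ (c * J)    ∎)
  r : ℕ
  r = c * J ∸ E
  E+r≡cJ : E + r ≡ c * J
  E+r≡cJ = m+[n∸m]≡n E≤cJ
  J^E≤B^r : J ^ E ≤ B ^ r
  J^E≤B^r = *-cancelˡ-≤ (B ^ E) {{m^n≢0 B E}} (begin
    B ^ E * J ^ E  ≡⟨ sym [BJ]^E≡B^E*J^E ⟩
    (B * J) ^ E    ≤⟨ [BJ]^E≤B^[cJ] ⟩
    B ^ (c * J)    ≡⟨ cong (B ^_) (sym E+r≡cJ) ⟩
    B ^ (E + r)    ≡⟨ ^-distribˡ-+-* B E r ⟩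
    B ^ E * B ^ r  ∎)

LnPowLe-intro : ∀ {B N J E} c → 1 < B → .{{_ : NonZero J}} → B ^ J ≤ N →
                (B * J) ^ E ≤ B ^ (c * J) → LnPowLe N E (N ^ c)
LnPowLe-intro {B} {N} {J} {E} c 1<B B^J≤N [BJ]^E≤B^[cJ] u v e^u≤N^v = ^-cancelʳ-≤ J (begin
  (u ^ E) ^ J                        ≡⟨ ^-swap u E J ⟩
  (u ^ J) ^ E                        ≤⟨ ^-monoˡ-≤ E (ExpLe⇒u^J≤N*[J*v]^J e^u≤N^v J) ⟩
  (N * (J * v) ^ J) ^ E              ≡⟨ expand ⟩
  N ^ E * (J ^ E) ^ J * (v ^ E) ^ J  ≤⟨ *-monoˡ-≤ ((v ^ E) ^ J)
                                          (N^E*[J^E]^J≤N^[c*J] {E = E} c 1<B B^J≤N [BJ]^E≤B^[cJ]) ⟩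
  N ^ (c * J) * (v ^ E) ^ J          ≡⟨ cong (_* (v ^ E) ^ J) (sym (^-*-assoc N c J)) ⟩
  (N ^ c) ^ J * (v ^ E) ^ J          ≡⟨ sym (^-distribʳ-* (N ^ c) (v ^ E) J) ⟩
  (N ^ c * v ^ E) ^ J                ∎)
  where
  open ≤-Reasoning
  expand : (N * (J * v) ^ J) ^ E ≡ N ^ E * (J ^ E) ^ J * (v ^ E) ^ J
  expand = begin-equality
    (N * (J * v) ^ J) ^ E                ≡⟨ ^-distribʳ-* N ((J * v) ^ J) E ⟩
    N ^ E * ((J * v) ^ J) ^ E            ≡⟨ cong (N ^ E *_) (^-swap (J * v) J E) ⟩
    N ^ E * ((J * v) ^ E) ^ J            ≡⟨ cong (λ x → N ^ E * x ^ J) (^-distribʳ-* J v E) ⟩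
    N ^ E * (J ^ E * v ^ E) ^ J          ≡⟨ cong (N ^ E *_) (^-distribʳ-* (J ^ E) (v ^ E) J) ⟩
    N ^ E * ((J ^ E) ^ J * (v ^ E) ^ J)  ≡⟨ sym (*-assoc (N ^ E) _ _) ⟩
    N ^ E * (J ^ E) ^ J * (v ^ E) ^ J    ∎

-- m is a power of two of size about X^(q/(q+1)), small enough that A · m · log₂ X ≤ X.
∃-small-root : ∀ A q → ∃[ X₀ ] (∀ {X} → X₀ ≤ X → ∃[ m ] (X ^ q ≤ m ^ suc q × X ^ (A * m) ≤ 2 ^ X))
∃-small-root A q = suc ((2 ^ p) ^ z₀) , root
  where
  p A′ z₀ : ℕ
  p  = suc q
  A′ = p * A * 2 ^ q
  z₀ = 4 + A′
  1<2^p : 1 < 2 ^ p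
  1<2^p = ^-monoʳ-< 2 (s≤s (s≤s z≤n)) {0} {p} (s≤s z≤n)
  root : ∀ {X} → suc ((2 ^ p) ^ z₀) ≤ X → ∃[ m ] (X ^ q ≤ m ^ p × X ^ (A * m) ≤ 2 ^ X)
  root {X} X₀≤X with z , [2^p]^z<X , X≤[2^p]^[1+z]
                      ← ∃-power-bracket (2 ^ p) X 1<2^p (≤-trans (s≤s (m^n>0 (2 ^ p) {{m^n≢0 2 p}} z₀)) X₀≤X)
    = (2 ^ q) ^ suc z , X^q≤m^p , X^[Am]≤2^X
    where
    open ≤-Reasoning
    z₀≤z : z₀ ≤ z
    z₀≤z = ≮⇒≥ (λ z<z₀ → <-irrefl refl
      (≤-trans (s≤s (≤-trans X≤[2^p]^[1+z] (^-monoʳ-≤ (2 ^ p) {{m^n≢0 2 p}} z<z₀))) X₀≤X))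
    X^q≤m^p : X ^ q ≤ ((2 ^ q) ^ suc z) ^ p
    X^q≤m^p = begin
      X ^ q                   ≤⟨ ^-monoˡ-≤ q X≤[2^p]^[1+z] ⟩
      ((2 ^ p) ^ suc z) ^ q   ≡⟨ ^-swap (2 ^ p) (suc z) q ⟩
      ((2 ^ p) ^ q) ^ suc z   ≡⟨ cong (_^ suc z) (^-swap 2 p q) ⟩
      ((2 ^ q) ^ p) ^ suc z   ≡⟨ ^-swap (2 ^ q) p (suc z) ⟩
      ((2 ^ q) ^ suc z) ^ p   ∎
    exponent≤X : p * suc z * (A * (2 ^ q) ^ suc z) ≤ X
    exponent≤X = <⇒≤ (begin-strict
      p * suc z * (A * (2 ^ q * (2 ^ q) ^ z))  ≡⟨ regroup p z A (2 ^ q) ((2 ^ q) ^ z) ⟩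
      A′ * suc z * (2 ^ q) ^ z                 ≤⟨ *-monoˡ-≤ ((2 ^ q) ^ z) (m*[1+n]≤2^n A′ z z₀≤z) ⟩
      2 ^ z * (2 ^ q) ^ z                      ≡⟨ sym (^-distribʳ-* 2 (2 ^ q) z) ⟩
      (2 ^ p) ^ z                              <⟨ [2^p]^z<X ⟩
      X                                        ∎)
      where
      regroup : ∀ p z A Q W → p * (1 + z) * (A * (Q * W)) ≡ p * A * Q * (1 + z) * W
      regroup = solve-∀
    X^[Am]≤2^X : X ^ (A * (2 ^ q) ^ suc z) ≤ 2 ^ X
    X^[Am]≤2^X = begin
      X ^ (A * (2 ^ q) ^ suc z)                ≤⟨ ^-monoˡ-≤ (A * (2 ^ q) ^ suc z) X≤[2^p]^[1+z] ⟩
      ((2 ^ p) ^ suc z) ^ (A * (2 ^ q) ^ suc z) ≡⟨ cong (_^ (A * (2 ^ q) ^ suc z)) (^-*-assoc 2 p (suc z)) ⟩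
      (2 ^ (p * suc z)) ^ (A * (2 ^ q) ^ suc z) ≡⟨ ^-*-assoc 2 (p * suc z) (A * (2 ^ q) ^ suc z) ⟩
      2 ^ (p * suc z * (A * (2 ^ q) ^ suc z))   ≤⟨ ^-monoʳ-≤ 2 exponent≤X ⟩
      2 ^ X                                     ∎

X^[q*T]≤T!^[2+q] : ∀ {X m T} q .{{_ : NonZero X}} → X ^ suc q ≤ m ^ (2 + q) → suc q * m ≤ T →
                   X ^ (q * T) ≤ (T !) ^ (2 + q)
X^[q*T]≤T!^[2+q] {X} {m} {T} q X^[1+q]≤m^[2+q] [1+q]m≤T = begin
  X ^ (q * T)              ≤⟨ ^-monoʳ-≤ X qT≤[1+q][T∸m] ⟩
  X ^ (suc q * (T ∸ m))    ≡⟨ sym (^-*-assoc X (suc q) (T ∸ m)) ⟩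
  (X ^ suc q) ^ (T ∸ m)    ≤⟨ ^-monoˡ-≤ (T ∸ m) X^[1+q]≤m^[2+q] ⟩
  (m ^ (2 + q)) ^ (T ∸ m)  ≡⟨ ^-swap m (2 + q) (T ∸ m) ⟩
  (m ^ (T ∸ m)) ^ (2 + q)  ≤⟨ ^-monoˡ-≤ (2 + q) m^[T∸m]≤T! ⟩
  (T !) ^ (2 + q)          ∎
  where
  open ≤-Reasoning
  m≤T : m ≤ T
  m≤T = ≤-trans (m≤n*m m (suc q)) [1+q]m≤T
  m^[T∸m]≤T! : m ^ (T ∸ m) ≤ T !
  m^[T∸m]≤T! = ≤-trans (m^n≤[m+n]! m (T ∸ m)) (≤-reflexive (cong _! (m+[n∸m]≡n m≤T)))
  qT≤[1+q][T∸m] : q * T ≤ suc q * (T ∸ m)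
  qT≤[1+q][T∸m] = ≤-trans
    (m+n≤o⇒m≤o∸n (q * T) (≤-trans (+-monoʳ-≤ (q * T) [1+q]m≤T) (≤-reflexive (+-comm (q * T) T))))
    (≤-reflexive (sym (*-distribˡ-∸ (suc q) T m)))

2^[c*J*q]≤T!^[[2+q]*d] : ∀ {q d c J m T} .{{_ : NonZero d}} → 1 ≤ J → 1 ≤ c →
  (2 * J) ^ suc q ≤ m ^ (2 + q) → (2 * J) ^ (suc q * (d * 2) * m) ≤ 2 ^ (2 * J) →
  2 ^ (c * J) ≤ ((2 * J) ^ d) ^ T → 2 ^ (c * J * q) ≤ (T !) ^ ((2 + q) * d)
2^[c*J*q]≤T!^[[2+q]*d] {q} {d} {c} {J} {m} {T} 1≤J 1≤c X^[1+q]≤m^[2+q] X^[Am]≤2^X 2^[cJ]≤[X^d]^T = begin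
  2 ^ (c * J * q)        ≡⟨ sym (^-*-assoc 2 (c * J) q) ⟩
  (2 ^ (c * J)) ^ q      ≤⟨ ^-monoˡ-≤ q 2^[cJ]≤[X^d]^T ⟩
  ((X ^ d) ^ T) ^ q      ≡⟨ trans (^-swap (X ^ d) T q) (cong (_^ T) (^-swap X d q)) ⟩
  ((X ^ q) ^ d) ^ T      ≡⟨ trans (^-swap (X ^ q) d T) (cong (_^ d) (^-*-assoc X q T)) ⟩
  (X ^ (q * T)) ^ d      ≤⟨ ^-monoˡ-≤ d (X^[q*T]≤T!^[2+q] q {{X≢0}} X^[1+q]≤m^[2+q] [1+q]m≤T) ⟩
  ((T !) ^ (2 + q)) ^ d  ≡⟨ ^-*-assoc (T !) (2 + q) d ⟩
  (T !) ^ ((2 + q) * d)  ∎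
  where
  open ≤-Reasoning
  X : ℕ
  X = 2 * J
  1<X : 1 < X
  1<X = *-monoʳ-≤ 2 1≤J
  X≢0 : NonZero X
  X≢0 = >-nonZero (<-trans (s≤s z≤n) 1<X)
  [1+q]m≤T : suc q * m ≤ T
  [1+q]m≤T = *-cancelʳ-≤ (suc q * m) T (d * 2) {{m*n≢0 d 2}} (begin
    suc q * m * (d * 2)  ≡⟨ *-Comm.xy∙z≈xz∙y (suc q) m (d * 2) ⟩
    suc q * (d * 2) * m  ≤⟨ ^-cancelˡ-≤ X 1<X (begin
      X ^ (suc q * (d * 2) * m)  ≤⟨ X^[Am]≤2^X ⟩
      2 ^ X                      ≤⟨ ^-monoʳ-≤ 2 (≤-trans (≤-reflexive (*-comm 2 J))
                                                        (*-monoˡ-≤ 2 (m≤n*m J c {{>-nonZero 1≤c}}))) ⟩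
      2 ^ (c * J * 2)            ≡⟨ sym (^-*-assoc 2 (c * J) 2) ⟩
      (2 ^ (c * J)) ^ 2          ≤⟨ ^-monoˡ-≤ 2 2^[cJ]≤[X^d]^T ⟩
      ((X ^ d) ^ T) ^ 2          ≡⟨ trans (^-*-assoc (X ^ d) T 2) (^-*-assoc X d (T * 2)) ⟩
      X ^ (d * (T * 2))          ∎) ⟩
    d * (T * 2)          ≡⟨ *-Comm.x∙yz≈y∙xz d T 2 ⟩
    T * (d * 2)          ∎)

-- Real form: T ≥ cJ / (d log₂ 2J) implies log₂ T! ≥ (q / (q + 2)) · cJ / d.
T!-Growth : (q d J₀ : ℕ) → Set
T!-Growth q d J₀ = ∀ c {J T} → 1 ≤ c → J₀ ≤ J →
                   2 ^ (c * J) ≤ ((2 * J) ^ d) ^ T → 2 ^ (c * J * q) ≤ (T !) ^ ((2 + q) * d)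

∃-T!-growth : ∀ q d .{{_ : NonZero d}} → ∃ (T!-Growth q d)
∃-T!-growth q d =
  let X₀ , root = ∃-small-root (suc q * (d * 2)) (suc q)
  in suc X₀ , λ c {J} {T} 1≤c X₀<J →
       let m , X^[1+q]≤m^[2+q] , X^[Am]≤2^X = root (≤-trans (n≤1+n X₀) (≤-trans X₀<J (m≤n*m J 2)))
       in 2^[c*J*q]≤T!^[[2+q]*d] {c = c} {T = T} (≤-trans (s≤s z≤n) X₀<J) 1≤c X^[1+q]≤m^[2+q] X^[Am]≤2^X

H*[3+2H]*[1+J]≤[1+H]*[1+2H]*J : ∀ H J → H * (3 + 2 * H) ≤ J →
                                H * (3 + 2 * H) * suc J ≤ suc H * (1 + 2 * H) * J
H*[3+2H]*[1+J]≤[1+H]*[1+2H]*J H J H[3+2H]≤J = begin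
  H * (3 + 2 * H) * suc J                ≡⟨ *-suc (H * (3 + 2 * H)) J ⟩
  H * (3 + 2 * H) + H * (3 + 2 * H) * J  ≤⟨ +-monoˡ-≤ (H * (3 + 2 * H) * J) H[3+2H]≤J ⟩
  J + H * (3 + 2 * H) * J                ≡⟨ expand H J ⟩
  suc H * (1 + 2 * H) * J                ∎
  where
  open ≤-Reasoning
  expand : ∀ H J → J + H * (3 + 2 * H) * J ≡ (1 + H) * (1 + 2 * H) * J
  expand = solve-∀

Cutoff : (a b c d N K : ℕ) → Set
Cutoff a b c d N K = N ^ (b + a) < (suc K !) ^ b × (∀ {k} → k ≤ K → LogBound c d N k)

module _ (a b c d : ℕ) .{{_ : NonZero b}} .{{_ : NonZero d}} (H<cb : (b + a) * d < c * b) where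

  private
    H q HP : ℕ
    H  = (b + a) * d
    q  = 1 + 2 * H  -- least q with H (2 + q) < (1 + H) q ≤ c b q
    HP = H * (2 + q)
    instance
      c≢0 : NonZero c
      c≢0 = m*n≢0⇒m≢0 c {{>-nonZero (≤-<-trans z≤n H<cb)}}
      b+a≢0 : NonZero (b + a)
      b+a≢0 = >-nonZero (≤-trans (>-nonZero⁻¹ b) (m≤m+n b a))

  2^[[1+J]*[b+a]]≤T!^b : ∀ {J T} → HP ≤ J → 2 ^ (c * J * q) ≤ (T !) ^ ((2 + q) * d) →
                         2 ^ (suc J * (b + a)) ≤ (T !) ^ b
  2^[[1+J]*[b+a]]≤T!^b {J} {T} HP≤J 2^[cJq]≤T!^[Pd] = ^-cancelʳ-≤ (P * d) {{m*n≢0 P d}} (begin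
    (2 ^ (suc J * (b + a))) ^ (P * d)  ≡⟨ ^-*-assoc 2 (suc J * (b + a)) (P * d) ⟩
    2 ^ (suc J * (b + a) * (P * d))    ≡⟨ cong (2 ^_) (regroup J (b + a) P d) ⟩
    2 ^ (H * P * suc J)                ≤⟨ ^-monoʳ-≤ 2 (≤-trans (H*[3+2H]*[1+J]≤[1+H]*[1+2H]*J H J HP≤J)
                                                               (*-monoˡ-≤ J (*-monoˡ-≤ q H<cb))) ⟩
    2 ^ (c * b * q * J)                ≡⟨ cong (2 ^_) (rearrange c b q J) ⟩
    2 ^ (c * J * q * b)                ≡⟨ sym (^-*-assoc 2 (c * J * q) b) ⟩
    (2 ^ (c * J * q)) ^ b              ≤⟨ ^-monoˡ-≤ b 2^[cJq]≤T!^[Pd] ⟩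
    ((T !) ^ (P * d)) ^ b              ≡⟨ ^-swap (T !) (P * d) b ⟩
    ((T !) ^ b) ^ (P * d)              ∎)
    where
    open ≤-Reasoning
    P : ℕ
    P = 2 + q
    regroup : ∀ J s P d → (1 + J) * s * (P * d) ≡ s * d * P * (1 + J)
    regroup = solve-∀
    rearrange : ∀ c b q J → c * b * q * J ≡ c * J * q * b
    rearrange = solve-∀

  cutoff-at : ∀ {J₀ N J K} → T!-Growth q d J₀ → J₀ + HP < J → 2 ^ J ≤ N → N < 2 ^ suc J →
              ((2 * J) ^ d) ^ K < 2 ^ (c * J) → 2 ^ (c * J) ≤ ((2 * J) ^ d) ^ suc K → Cutoff a b c d N K
  cutoff-at {J₀} {N} {J} {K} growth L<J 2^J≤N N<2^[1+J] [X^d]^K<2^[cJ] 2^[cJ]≤[X^d]^[1+K] =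
    N^[b+a]<[1+K]!^b , logBound
    where
    open ≤-Reasoning
    1≤J : 1 ≤ J
    1≤J = ≤-<-trans z≤n L<J
    instance
      J≢0 : NonZero J
      J≢0 = >-nonZero 1≤J
      [2J]^d≢0 : NonZero ((2 * J) ^ d)
      [2J]^d≢0 = m^n≢0 (2 * J) d {{m*n≢0 2 J}}
    N^[b+a]<[1+K]!^b : N ^ (b + a) < (suc K !) ^ b
    N^[b+a]<[1+K]!^b = begin-strict
      N ^ (b + a)            <⟨ ^-monoˡ-< (b + a) N<2^[1+J] ⟩
      (2 ^ suc J) ^ (b + a)  ≡⟨ ^-*-assoc 2 (suc J) (b + a) ⟩
      2 ^ (suc J * (b + a))  ≤⟨ 2^[[1+J]*[b+a]]≤T!^b {T = suc K} (≤-trans (m≤n+m HP J₀) (<⇒≤ L<J))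
                                  (growth c {T = suc K} 1≤c (≤-trans (m≤m+n J₀ HP) (<⇒≤ L<J)) 2^[cJ]≤[X^d]^[1+K]) ⟩
      (suc K !) ^ b          ∎
      where
      1≤c : 1 ≤ c
      1≤c = >-nonZero⁻¹ c
    logBound : ∀ {k} → k ≤ K → LogBound c d N k
    logBound {k} k≤K = LnPowLe-intro {2} {N} {J} {k * d} c (s≤s (s≤s z≤n)) 2^J≤N (begin
      (2 * J) ^ (k * d)  ≡⟨ trans (cong ((2 * J) ^_) (*-comm k d)) (sym (^-*-assoc (2 * J) d k)) ⟩
      ((2 * J) ^ d) ^ k  ≤⟨ ^-monoʳ-≤ ((2 * J) ^ d) k≤K ⟩
      ((2 * J) ^ d) ^ K  <⟨ [X^d]^K<2^[cJ] ⟩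
      2 ^ (c * J)        ∎)

  cutoff-above : ∀ {J₀ N} → T!-Growth q d J₀ → 2 ^ suc (J₀ + HP) ≤ N → ∃ (Cutoff a b c d N)
  cutoff-above {J₀} {N} growth N₀≤N =
    let J , 2^J≤N , N<2^[1+J] = ∃-⌊log₂⌋ N (≤-trans (m^n>0 2 (suc (J₀ + HP))) N₀≤N)
        L<J = s≤s⁻¹ (^-cancelˡ-< 2 {suc (J₀ + HP)} {suc J} (≤-<-trans N₀≤N N<2^[1+J]))
        1≤J = ≤-<-trans z≤n L<J
        K , [X^d]^K<2^[cJ] , 2^[cJ]≤[X^d]^[1+K] =
          ∃-power-bracket ((2 * J) ^ d) (2 ^ (c * J)) (^-monoʳ-< (2 * J) (*-monoʳ-≤ 2 1≤J) (>-nonZero⁻¹ d))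
                          (^-monoʳ-< 2 (s≤s (s≤s z≤n)) (≤-trans 1≤J (m≤n*m J c)))
    in K , cutoff-at growth L<J 2^J≤N N<2^[1+J] [X^d]^K<2^[cJ] 2^[cJ]≤[X^d]^[1+K]

  ∃-cutoff : ∃[ N₀ ] (∀ {N} → N₀ ≤ N → ∃ (Cutoff a b c d N))
  ∃-cutoff = let J₀ , growth = ∃-T!-growth q d in 2 ^ suc (J₀ + HP) , cutoff-above growth

proposition2p1 : (a b c d : ℕ) → .{{_ : NonZero a}} → .{{_ : NonZero b}} → .{{_ : NonZero d}} →
    (b + a) * d < c * b →
    ∃[ N₀ ] ((N : ℕ) → N₀ ≤ N →
      (𝒮 : List (Subset (N * N))) → Unique 𝒮 → All (λ S → ∣ S ∣ ≡ N) 𝒮 →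
      length 𝒮 ^ b ≤ N ^ (b + a) →
      LogBound c d N (C N 𝒮))
proposition2p1 a b c d H<cb =
  let N₀ , cutoff = ∃-cutoff a b c d H<cb
  in suc N₀ , λ N N₀<N 𝒮 _ N-sets |𝒮|^b≤N^[b+a] →
       let K , N^[b+a]<[1+K]!^b , logBound = cutoff (<⇒≤ N₀<N)
       in logBound (length<[1+K]!⇒C≤K {{>-nonZero (≤-<-trans z≤n N₀<N)}} N-sets
                      (^-cancelʳ-< b (≤-<-trans |𝒮|^b≤N^[b+a] N^[b+a]<[1+K]!^b)))
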